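{- Every bounded polytope $\mathcal{P} \subset \mathbb{R}^n$ can be equivalently represented in Z-representation; that is, there exist $c \in \mathbb{R}^n$, a generator matrix $G \in \mathbb{R}^{n \times h}$, an integer $p \ge 0$ and a tuple $\mathcal{E} = (e_1,\dots,e_h)$ as in the definition of Z-representation below such that $\mathcal{P} = \langle c, G, \mathcal{E}\rangle_Z$.
   Context: A bounded polytope is a set of the form $\{\sum_{i=1}^q \beta_i v_i \mid \beta_i \ge 0, \sum_{i=1}^q \beta_i = 1\}$ for finitely many points $v_1,\dots,v_q \in \mathbb{R}^n$, $q \ge 1$ (V-representation). Z-representation: given $c \in \mathbb{R}^n$, $G \in \mathbb{R}^{n\times h}$ (columns $G_{(\cdot,i)}$ are called generators, $h \ge 0$), a number of factors $p \ge 0$, and a tuple $\mathcal{E} = (e_1,\dots,e_h)$ where each $e_i \in \{1,\dots,p\}^{m_i}$ is a vector whose entries $e_{i(1)},\dots,e_{i(m_i)}$ are pairwise distinct, the set $\langle c,G,\mathcal{E}\rangle_Z$ is $$\Big\{ c + \sum_{i=1}^h \Big(\prod_{k=1}^{m_i} \alpha_{e_{i(k)}}\Big) G_{(\cdot,i)} \;\Big|\; \alpha_1,\dots,\alpha_p \in [-1,1]\Big\}$$ (an empty product equals $1$; with $h=0$, $G = [\,]$ the empty matrix and $\mathcal{E} = \emptyset$ the empty tuple, the set is $\{c\}$). -}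

module Defs where

open import Level using (0ℓ)
open import Data.Nat using (ℕ; zero; suc)
open import Data.Fin using (Fin; zero; suc)
open import Data.Product using (Σ; ∃; _×_; _,_)
open import Relation.Nullary using (¬_)
open import Relation.Binary.Structures using (IsTotalOrder)
open import Function.Definitions using (Injective)
open import Relation.Binary.PropositionalEquality using (_≡_)
open import Algebra.Bundles using (CommutativeRing)

-- An axiomatisation of the real numbers: a Dedekind-complete ordered field
-- (unique up to isomorphism; ℝ is not available in agda-stdlib).
record RealField : Set₁ where
  field
    commRing : CommutativeRing 0ℓ 0ℓ
  open CommutativeRing commRing public hiding (ring)
  field
    _≤_           : Carrier → Carrier → Set
    isTotalOrder  : IsTotalOrder _≈_ _≤_
    nontrivial    : ¬ (0# ≈ 1#)
    +-mono-≤      : ∀ x y z → x ≤ y → (x + z) ≤ (y + z)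
    *-nonneg      : ∀ x y → 0# ≤ x → 0# ≤ y → 0# ≤ (x * y)
    inverse       : ∀ x → ¬ (x ≈ 0#) → Σ Carrier λ y → (x * y) ≈ 1#
    complete      : (S : Carrier → Set) → Σ Carrier S →
                    Σ Carrier (λ b → ∀ s → S s → s ≤ b) →
                    Σ Carrier (λ u → (∀ s → S s → s ≤ u) ×
                                     (∀ b → (∀ s → S s → s ≤ b) → u ≤ b))

module _ (R : RealField) where
  open RealField R using (Carrier; _≈_; _≤_; _+_; _*_; -_; 0#; 1#)

  Point : ℕ → Set
  Point n = Fin n → Carrier

  Sum : (m : ℕ) → (Fin m → Carrier) → Carrier
  Sum zero    f = 0#
  Sum (suc m) f = f zero + Sum m (λ i → f (suc i))

  Prod : (m : ℕ) → (Fin m → Carrier) → Carrier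
  Prod zero    f = 1#
  Prod (suc m) f = f zero * Prod m (λ i → f (suc i))

  _≈ᵥ_ : {n : ℕ} → Point n → Point n → Set
  x ≈ᵥ y = ∀ j → x j ≈ y j

  InVPolytope : {n q : ℕ} → (Fin q → Point n) → Point n → Set
  InVPolytope {n} {q} v x =
    Σ (Fin q → Carrier) λ β →
      (∀ i → 0# ≤ β i) × (Sum q β ≈ 1#) ×
      (x ≈ᵥ (λ j → Sum q (λ i → β i * v i j)))

  -- an exponent vector e_i ∈ {1,…,p}^{m_i} with pairwise distinct entries
  -- (factors indexed by Fin p)
  record ExpVec (p : ℕ) : Set where
    constructor expVec
    field
      len     : ℕ
      entries : Fin len → Fin p
      distinct : Injective _≡_ _≡_ entries

  -- membership in ⟨c, G, E⟩_Z ; G given by its h columns G i : Point n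
  InZ : {n h p : ℕ} → Point n → (Fin h → Point n) → (Fin h → ExpVec p) →
        Point n → Set
  InZ {n} {h} {p} c G E x =
    Σ (Fin p → Carrier) λ α →
      (∀ k → ((- 1#) ≤ α k) × (α k ≤ 1#)) ×
      (x ≈ᵥ (λ j → c j + Sum h (λ i →
                 Prod (ExpVec.len (E i)) (λ k → α (ExpVec.entries (E i) k)) * G i j)))

module Submission where

-- Z-representations are closed under joins: if  ⟨A⟩  and  ⟨B⟩  are
-- Z-represented sets, one extra factor  α₀ ∈ [-1, 1]  used as the mixing weight
-- ((1 + α₀)/2, (1 - α₀)/2)  represents the set of all convex combinations of a
-- point of  ⟨A⟩  and a point of  ⟨B⟩  (join, Image-join⁺/⁻).  For each vertex
-- v_k  the chain  join(v_{i₁}, join(v_{i₂}, … v_k))  over the other vertices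
-- contains every convex combination whose weight of  v_k  is nonzero: peel off
-- the first point and renormalise the rest by the remaining mass, which is at
-- least the weight of  v_k  (split-first).  Every point of the polytope has a
-- vertex of maximal, hence nonzero, weight, so it lies in the join of all  q + 1
-- chains; conversely that join lies in the polytope, which is convex and
-- contains the vertices.

open import Defs
open import Data.Nat using (ℕ; suc)
open import Data.Fin using (Fin)
open import Data.Product using (Σ; _×_)
open import Function.Bundles using (_⇔_)

open import Data.Nat using (zero) renaming (_+_ to _+ℕ_)
open import Data.Fin using (zero; suc; punchIn; _↑ˡ_; _↑ʳ_; splitAt; _≟_)
open import Data.Fin.Properties using (↑ˡ-injective; ↑ʳ-injective; suc-injective; punchInᵢ≢i)
open import Data.Vec.Functional using (_∷_; _++_; tail)
open import Data.Vec.Functional.Properties using (lookup-++ˡ; lookup-++ʳ)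
open import Data.Product using (_,_; proj₁; proj₂)
open import Data.Sum using (inj₁; inj₂)
open import Data.Sum.Properties using ([,]-map; [,]-∘)
open import Data.Empty using (⊥-elim)
open import Relation.Nullary using (¬_; yes; no)
open import Relation.Binary.PropositionalEquality as ≡ using (_≡_)
open import Relation.Binary.Structures using (IsTotalOrder)
open import Function.Definitions using (Injective)
open import Function.Bundles using (mk⇔; Equivalence)
open import Algebra.Bundles using (CommutativeRing)
import Algebra.Properties.Ring as RingProperties
import Algebra.Properties.Group as GroupProperties
import Algebra.Solver.Ring.NaturalCoefficients.Default as NaturalSolver

module OrderedField (R : RealField) where
  open RealField R hiding (zero)
  open IsTotalOrder isTotalOrder public
    using (total; antisym) renaming (refl to ≤-refl; trans to ≤-trans)
  open IsTotalOrder isTotalOrder using (≲-respˡ-≈; ≲-respʳ-≈)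
  open GroupProperties +-group using (ε⁻¹≈ε; ⁻¹-involutive)
  open RingProperties (CommutativeRing.ring commRing) using (-1*x≈-x)
  open NaturalSolver (CommutativeRing.commutativeSemiring commRing) public using (solve; _:=_; _:+_; _:*_)
  open import Relation.Binary.Reasoning.Setoid setoid

  -- Ring identities are normalised by a commutative-semiring solver, so the
  -- constant  -1  enters them as an atom  -1#  together with  -1# * -1# ≈ 1#.
  -1# : Carrier
  -1# = - 1#

  -- The order of  RealField  carries no fixity, hence the parentheses around sums.
  ≤-resp-≈ : ∀ {a b c d} → a ≈ b → c ≈ d → a ≤ c → b ≤ d
  ≤-resp-≈ a≈b c≈d a≤c = ≲-respʳ-≈ c≈d (≲-respˡ-≈ a≈b a≤c)

  +-monoˡ-≤ : ∀ z {x y} → x ≤ y → (z + x) ≤ (z + y)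
  +-monoˡ-≤ z {x} {y} x≤y = ≤-resp-≈ (+-comm x z) (+-comm y z) (+-mono-≤ x y z x≤y)

  +-mono₂-≤ : ∀ {a b c d} → a ≤ b → c ≤ d → (a + c) ≤ (b + d)
  +-mono₂-≤ {a} {b} {c} a≤b c≤d = ≤-trans (+-mono-≤ a b c a≤b) (+-monoˡ-≤ b c≤d)

  -- Negation reverses the order: add  - x + - y  to both sides.
  neg-antitone : ∀ {x y} → x ≤ y → (- y) ≤ (- x)
  neg-antitone {x} {y} x≤y = ≤-resp-≈ (cancel x (- y)) cancel′ (+-mono-≤ x y (- x + - y) x≤y)
    where
    cancel : ∀ a b → a + (- a + b) ≈ b
    cancel a b = begin
      a + (- a + b)   ≈⟨ +-assoc a (- a) b ⟨
      (a + - a) + b   ≈⟨ +-congʳ (-‿inverseʳ a) ⟩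
      0# + b          ≈⟨ +-identityˡ b ⟩
      b               ∎
    cancel′ : y + (- x + - y) ≈ - x
    cancel′ = trans (+-congˡ (+-comm (- x) (- y))) (cancel y (- x))

  neg≈-1* : ∀ x → - x ≈ -1# * x
  neg≈-1* x = sym (-1*x≈-x x)

  x+-1*x≈0 : ∀ x → x + -1# * x ≈ 0#
  x+-1*x≈0 x = trans (+-congˡ (-1*x≈-x x)) (-‿inverseʳ x)

  -1*-1≈1 : -1# * -1# ≈ 1#
  -1*-1≈1 = trans (-1*x≈-x -1#) (⁻¹-involutive 1#)

  -1*-nonpos : ∀ {s} → 0# ≤ s → (-1# * s) ≤ 0#
  -1*-nonpos 0≤s = ≤-resp-≈ (neg≈-1* _) ε⁻¹≈ε (neg-antitone 0≤s)

  -- In an ordered field squares are nonnegative, so  1 = (-1)·(-1) ≥ 0.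
  0≤1 : 0# ≤ 1#
  0≤1 with total 0# 1#
  ... | inj₁ 0≤1 = 0≤1
  ... | inj₂ 1≤0 = ≤-resp-≈ refl -1*-1≈1 (*-nonneg -1# -1# 0≤-1 0≤-1)
    where
    0≤-1 : 0# ≤ -1#
    0≤-1 = ≤-resp-≈ ε⁻¹≈ε refl (neg-antitone 1≤0)

  -1≤0 : -1# ≤ 0#
  -1≤0 = ≤-resp-≈ refl ε⁻¹≈ε (neg-antitone 0≤1)

  1≉0 : ¬ (1# ≈ 0#)
  1≉0 1≈0 = nontrivial (sym 1≈0)

  -- The inverse of a nonnegative element is nonnegative: otherwise
  --  -1 = r · ((-1) · y) ≥ 0, contradicting 0 ≤ 1 and 0 ≉ 1.
  inverse-nonneg : ∀ {r y} → 0# ≤ r → r * y ≈ 1# → 0# ≤ y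
  inverse-nonneg {r} {y} 0≤r ry≈1 with total 0# y
  ... | inj₁ 0≤y = 0≤y
  ... | inj₂ y≤0 = ⊥-elim (1≉0 (antisym 1≤0 0≤1))
    where
    0≤-1*y : 0# ≤ (-1# * y)
    0≤-1*y = ≤-resp-≈ ε⁻¹≈ε (neg≈-1* y) (neg-antitone y≤0)
    r[-1*y]≈-1 : r * (-1# * y) ≈ -1#
    r[-1*y]≈-1 = begin
      r * (-1# * y)   ≈⟨ solve 3 (λ r m y → (r :* (m :* y)) := (m :* (r :* y))) refl r -1# y ⟩
      -1# * (r * y)   ≈⟨ *-congˡ ry≈1 ⟩
      -1# * 1#        ≈⟨ *-identityʳ -1# ⟩
      -1#             ∎
    1≤0 : 1# ≤ 0#
    1≤0 = ≤-resp-≈ (⁻¹-involutive 1#) ε⁻¹≈ε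
            (neg-antitone (≤-resp-≈ refl r[-1*y]≈-1 (*-nonneg r (-1# * y) 0≤r 0≤-1*y)))

  2≉0 : ¬ (1# + 1# ≈ 0#)
  2≉0 2≈0 = 1≉0 (antisym 1≤0 0≤1)
    where
    1≤0 : 1# ≤ 0#
    1≤0 = ≤-resp-≈ (+-identityʳ 1#) 2≈0 (+-monoˡ-≤ 1# 0≤1)

  ½ : Carrier
  ½ = proj₁ (inverse (1# + 1#) 2≉0)

  ½+½≈1 : ½ + ½ ≈ 1#
  ½+½≈1 = begin
    ½ + ½               ≈⟨ +-cong (*-identityˡ ½) (*-identityˡ ½) ⟨
    1# * ½ + 1# * ½     ≈⟨ distribʳ ½ 1# 1# ⟨
    (1# + 1#) * ½       ≈⟨ proj₂ (inverse (1# + 1#) 2≉0) ⟩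
    1#                  ∎

  0≤½ : 0# ≤ ½
  0≤½ = inverse-nonneg (≤-resp-≈ (+-identityˡ 0#) refl (+-mono₂-≤ 0≤1 0≤1))
                       (proj₂ (inverse (1# + 1#) 2≉0))

  ½*[a+-1*a]≈0 : ∀ a → ½ * (a + -1# * a) ≈ 0#
  ½*[a+-1*a]≈0 a = trans (*-congˡ (x+-1*x≈0 a)) (zeroʳ ½)

  -- The affine map  a ↦ ((1 + a)/2, (1 - a)/2)  sends the interval [-1, 1]
  -- onto the pairs of nonnegative weights with sum 1; its inverse is
  -- (t, s) ↦ t - s.  It turns a factor α ∈ [-1, 1] into a convex combination.
  weight⁺ weight⁻ : Carrier → Carrier
  weight⁺ a = ½ + ½ * a
  weight⁻ a = ½ + ½ * (-1# * a)

  weights-sum : ∀ a → weight⁺ a + weight⁻ a ≈ 1#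
  weights-sum a = begin
    weight⁺ a + weight⁻ a
      ≈⟨ solve 3 (λ h m a → ((h :+ (h :* a)) :+ (h :+ (h :* (m :* a))))
                         := ((h :+ h) :+ (h :* (a :+ (m :* a))))) refl ½ -1# a ⟩
    (½ + ½) + ½ * (a + -1# * a)   ≈⟨ +-cong ½+½≈1 (½*[a+-1*a]≈0 a) ⟩
    1# + 0#                       ≈⟨ +-identityʳ 1# ⟩
    1#                            ∎

  ½*[1+x] : ∀ x → ½ * (1# + x) ≈ ½ + ½ * x
  ½*[1+x] x = trans (distribˡ ½ 1# x) (+-congʳ (*-identityʳ ½))

  weight⁺-nonneg : ∀ {a} → -1# ≤ a → 0# ≤ weight⁺ a
  weight⁺-nonneg {a} -1≤a = ≤-resp-≈ refl (½*[1+x] a) (*-nonneg ½ _ 0≤½ 0≤1+a)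
    where
    0≤1+a : 0# ≤ (1# + a)
    0≤1+a = ≤-resp-≈ (-‿inverseʳ 1#) refl (+-monoˡ-≤ 1# -1≤a)

  weight⁻-nonneg : ∀ {a} → a ≤ 1# → 0# ≤ weight⁻ a
  weight⁻-nonneg {a} a≤1 = ≤-resp-≈ refl (½*[1+x] (-1# * a)) (*-nonneg ½ _ 0≤½ 0≤1-a)
    where
    0≤1-a : 0# ≤ (1# + -1# * a)
    0≤1-a = ≤-resp-≈ (x+-1*x≈0 a) refl (+-mono-≤ a 1# (-1# * a) a≤1)

  mixing-parameter : Carrier → Carrier → Carrier
  mixing-parameter t s = t + -1# * s

  mixing-parameter-bounds : ∀ {t s} → 0# ≤ t → 0# ≤ s → t + s ≈ 1# →
    (-1# ≤ mixing-parameter t s) × (mixing-parameter t s ≤ 1#)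
  mixing-parameter-bounds {t} {s} 0≤t 0≤s t+s≈1 =
    ≤-resp-≈ -t-s≈-1 refl (+-mono-≤ (-1# * t) t (-1# * s) (≤-trans (-1*-nonpos 0≤t) 0≤t)) ,
    ≤-resp-≈ refl t+s≈1 (+-monoˡ-≤ t (≤-trans (-1*-nonpos 0≤s) 0≤s))
    where
    -t-s≈-1 : -1# * t + -1# * s ≈ -1#
    -t-s≈-1 = trans (sym (distribˡ -1# t s)) (trans (*-congˡ t+s≈1) (*-identityʳ -1#))

  ½≈½*[t+s] : ∀ {t s} → t + s ≈ 1# → ½ ≈ ½ * (t + s)
  ½≈½*[t+s] t+s≈1 = sym (trans (*-congˡ t+s≈1) (*-identityʳ ½))

  weight⁺-mixing-parameter : ∀ {t s} → t + s ≈ 1# → weight⁺ (mixing-parameter t s) ≈ t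
  weight⁺-mixing-parameter {t} {s} t+s≈1 = begin
    ½ + ½ * (t + -1# * s)                ≈⟨ +-congʳ (½≈½*[t+s] t+s≈1) ⟩
    ½ * (t + s) + ½ * (t + -1# * s)
      ≈⟨ solve 4 (λ h m t s → ((h :* (t :+ s)) :+ (h :* (t :+ (m :* s))))
                         := (((h :+ h) :* t) :+ (h :* (s :+ (m :* s))))) refl ½ -1# t s ⟩
    (½ + ½) * t + ½ * (s + -1# * s)      ≈⟨ +-cong (*-congʳ ½+½≈1) (½*[a+-1*a]≈0 s) ⟩
    1# * t + 0#                          ≈⟨ trans (+-identityʳ _) (*-identityˡ t) ⟩
    t                                    ∎

  weight⁻-mixing-parameter : ∀ {t s} → t + s ≈ 1# → weight⁻ (mixing-parameter t s) ≈ s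
  weight⁻-mixing-parameter {t} {s} t+s≈1 = begin
    ½ + ½ * (-1# * (t + -1# * s))               ≈⟨ +-congʳ (½≈½*[t+s] t+s≈1) ⟩
    ½ * (t + s) + ½ * (-1# * (t + -1# * s))
      ≈⟨ solve 4 (λ h m t s → ((h :* (t :+ s)) :+ (h :* (m :* (t :+ (m :* s)))))
                         := ((h :* (t :+ (m :* t))) :+ (h :* (s :+ ((m :* m) :* s))))) refl ½ -1# t s ⟩
    ½ * (t + -1# * t) + ½ * (s + (-1# * -1#) * s)
      ≈⟨ +-cong (½*[a+-1*a]≈0 t) (*-congˡ (+-congˡ (trans (*-congʳ -1*-1≈1) (*-identityˡ s)))) ⟩
    0# + ½ * (s + s)
      ≈⟨ trans (+-identityˡ _) (solve 2 (λ h s → (h :* (s :+ s)) := ((h :+ h) :* s)) refl ½ s) ⟩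
    (½ + ½) * s                                 ≈⟨ trans (*-congʳ ½+½≈1) (*-identityˡ s) ⟩
    s                                           ∎

  argmax : ∀ q (β : Fin (suc q) → Carrier) → Σ (Fin (suc q)) λ k → ∀ i → β i ≤ β k
  argmax zero    β = zero , λ { zero → ≤-refl }
  argmax (suc q) β with argmax q (tail β)
  ... | k , βi≤βk with total (β zero) (β (suc k))
  ...   | inj₁ β0≤βk = suc k , λ { zero → β0≤βk ; (suc i) → βi≤βk i }
  ...   | inj₂ βk≤β0 = zero  , λ { zero → ≤-refl ; (suc i) → ≤-trans (βi≤βk i) βk≤β0 }

module FiniteSums (R : RealField) where
  open RealField R hiding (zero)
  open OrderedField R
  open import Relation.Binary.Reasoning.Setoid setoid

  Sum-cong : ∀ m {f g : Fin m → Carrier} → (∀ i → f i ≈ g i) → Sum R m f ≈ Sum R m g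
  Sum-cong zero    f≈g = refl
  Sum-cong (suc m) f≈g = +-cong (f≈g zero) (Sum-cong m (λ i → f≈g (suc i)))

  Prod-cong : ∀ m {f g : Fin m → Carrier} → (∀ i → f i ≈ g i) → Prod R m f ≈ Prod R m g
  Prod-cong zero    f≈g = refl
  Prod-cong (suc m) f≈g = *-cong (f≈g zero) (Prod-cong m (λ i → f≈g (suc i)))

  Sum-+ : ∀ m (f g : Fin m → Carrier) → Sum R m (λ i → f i + g i) ≈ Sum R m f + Sum R m g
  Sum-+ zero    f g = sym (+-identityˡ 0#)
  Sum-+ (suc m) f g = begin
    (f zero + g zero) + Sum R m (λ i → f (suc i) + g (suc i))
      ≈⟨ +-congˡ (Sum-+ m (tail f) (tail g)) ⟩
    (f zero + g zero) + (Sum R m (tail f) + Sum R m (tail g))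
      ≈⟨ solve 4 (λ a b c d → ((a :+ b) :+ (c :+ d)) := ((a :+ c) :+ (b :+ d))) refl _ _ _ _ ⟩
    (f zero + Sum R m (tail f)) + (g zero + Sum R m (tail g)) ∎

  Sum-scale : ∀ m k (f : Fin m → Carrier) → Sum R m (λ i → k * f i) ≈ k * Sum R m f
  Sum-scale zero    k f = sym (zeroʳ k)
  Sum-scale (suc m) k f =
    trans (+-congˡ (Sum-scale m k (tail f))) (sym (distribˡ k _ _))

  Sum-zero : ∀ m (f : Fin m → Carrier) → (∀ i → f i ≈ 0#) → Sum R m f ≈ 0#
  Sum-zero zero    f f≈0 = refl
  Sum-zero (suc m) f f≈0 =
    trans (+-cong (f≈0 zero) (Sum-zero m (tail f) (λ i → f≈0 (suc i)))) (+-identityˡ 0#)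

  Sum-nonneg : ∀ m (f : Fin m → Carrier) → (∀ i → 0# ≤ f i) → 0# ≤ Sum R m f
  Sum-nonneg zero    f 0≤f = ≤-refl
  Sum-nonneg (suc m) f 0≤f = ≤-resp-≈ (+-identityˡ 0#) refl
    (+-mono₂-≤ (0≤f zero) (Sum-nonneg m (tail f) (λ i → 0≤f (suc i))))

  Sum-punchIn : ∀ q (f : Fin (suc q) → Carrier) k →
                Sum R (suc q) f ≈ f k + Sum R q (λ i → f (punchIn k i))
  Sum-punchIn q       f zero    = refl
  Sum-punchIn (suc q) f (suc k) = begin
    f zero + Sum R (suc q) (tail f)
      ≈⟨ +-congˡ (Sum-punchIn q (tail f) k) ⟩
    f zero + (f (suc k) + Sum R q (λ i → f (suc (punchIn k i))))
      ≈⟨ solve 3 (λ a b c → (a :+ (b :+ c)) := (b :+ (a :+ c))) refl _ _ _ ⟩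
    f (suc k) + (f zero + Sum R q (λ i → f (suc (punchIn k i)))) ∎

  -- Dropping the first entry of an appended family (the library's  _++_  goes
  -- through  splitAt, which only reduces on constructors).
  ++-suc : ∀ {A : Set} m {n} (f : Fin (suc m) → A) (g : Fin n → A) i →
           (f ++ g) (suc i) ≡ (tail f ++ g) i
  ++-suc m f g i = [,]-map (splitAt m i)

  Sum-++ : ∀ m {n} (f : Fin m → Carrier) (g : Fin n → Carrier) →
           Sum R (m +ℕ n) (f ++ g) ≈ Sum R m f + Sum R n g
  Sum-++ zero    f g = sym (+-identityˡ _)
  Sum-++ (suc m) f g = begin
    f zero + Sum R (m +ℕ _) (λ i → (f ++ g) (suc i))
      ≈⟨ +-congˡ (Sum-cong (m +ℕ _) (λ i → reflexive (++-suc m f g i))) ⟩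
    f zero + Sum R (m +ℕ _) (tail f ++ g)      ≈⟨ +-congˡ (Sum-++ m (tail f) g) ⟩
    f zero + (Sum R m (tail f) + Sum R _ g)    ≈⟨ +-assoc _ _ _ ⟨
    (f zero + Sum R m (tail f)) + Sum R _ g    ∎

module ConvexSets (R : RealField) where
  open RealField R hiding (zero)
  open OrderedField R

  record Join {n} (P Q : Point R n → Set) (x : Point R n) : Set where
    constructor mix
    field
      t s      : Carrier
      a b      : Point R n
      0≤t      : 0# ≤ t
      0≤s      : 0# ≤ s
      t+s≈1    : t + s ≈ 1#
      a∈P      : P a
      b∈Q      : Q b
      x≈ta+sb  : _≈ᵥ_ R x (λ j → t * a j + s * b j)

  Convex : ∀ {n} → (Point R n → Set) → Set
  Convex P = ∀ x → Join P P x → P x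

  Join-map : ∀ {n} {P Q P′ Q′ : Point R n → Set} →
             (∀ x → P x → P′ x) → (∀ x → Q x → Q′ x) → ∀ x → Join P Q x → Join P′ Q′ x
  Join-map f g x (mix t s a b 0≤t 0≤s t+s≈1 a∈P b∈Q eq) =
    mix t s a b 0≤t 0≤s t+s≈1 (f a a∈P) (g b b∈Q) eq

  Join-left : ∀ {n} {P Q : Point R n → Set} {a b} → P a → Q b → Join P Q a
  Join-left {a = a} {b} a∈P b∈Q = mix 1# 0# a b 0≤1 ≤-refl (+-identityʳ 1#) a∈P b∈Q
    (λ j → sym (trans (+-cong (*-identityˡ (a j)) (zeroˡ (b j))) (+-identityʳ (a j))))

  Join-right : ∀ {n} {P Q : Point R n → Set} {a b} → P a → Q b → Join P Q b
  Join-right {a = a} {b} a∈P b∈Q = mix 0# 1# a b ≤-refl 0≤1 (+-identityˡ 1#) a∈P b∈Q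
    (λ j → sym (trans (+-cong (zeroˡ (a j)) (*-identityˡ (b j))) (+-identityˡ (b j))))

  convex-resp : ∀ {n} (P : Point R n → Set) → Convex P → ∀ {a x} → P a → _≈ᵥ_ R x a → P x
  convex-resp P P-convex {a} {x} a∈P x≈a = P-convex x (mix 1# 0# a a 0≤1 ≤-refl (+-identityʳ 1#) a∈P a∈P
    (λ j → trans (x≈a j) (sym (trans (+-cong (*-identityˡ (a j)) (zeroˡ (a j))) (+-identityʳ (a j))))))

module ZRepresentations (R : RealField) where
  open RealField R hiding (zero)
  open OrderedField R
  open FiniteSums R
  open ConvexSets R
  open import Relation.Binary.Reasoning.Setoid setoid

  Cube : ∀ {p} → (Fin p → Carrier) → Set
  Cube α = ∀ k → (-1# ≤ α k) × (α k ≤ 1#)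

  Cube-∷ : ∀ {p a} {α : Fin p → Carrier} → (-1# ≤ a) × (a ≤ 1#) → Cube α → Cube (a ∷ α)
  Cube-∷ a-bounds α-bounds zero    = a-bounds
  Cube-∷ a-bounds α-bounds (suc k) = α-bounds k

  Cube-++ : ∀ p {q} {α : Fin p → Carrier} {β : Fin q → Carrier} → Cube α → Cube β → Cube (α ++ β)
  Cube-++ p α-bounds β-bounds k with splitAt p k
  ... | inj₁ i = α-bounds i
  ... | inj₂ i = β-bounds i

  monomial : ∀ {p} → ExpVec R p → (Fin p → Carrier) → Carrier
  monomial e α = Prod R (ExpVec.len e) (λ k → α (ExpVec.entries e k))

  record Term (n p : ℕ) : Set where
    field
      coeff : Point R n
      exps  : ExpVec R p
  open Term

  record PolyMap (n p : ℕ) : Set where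
    constructor polyMap
    field
      size : ℕ
      term : Fin size → Term n p
  open PolyMap

  eval : ∀ {n p} → PolyMap n p → (Fin p → Carrier) → Point R n
  eval P α j = Sum R (size P) (λ i → monomial (exps (term P i)) α * coeff (term P i) j)

  eval-cong : ∀ {n p} (P : PolyMap n p) {α β : Fin p → Carrier} → (∀ k → α k ≡ β k) →
              ∀ j → eval P α j ≈ eval P β j
  eval-cong P α≡β j = Sum-cong (size P) λ i →
    *-congʳ (Prod-cong (ExpVec.len (exps (term P i))) (λ k → reflexive (α≡β _)))

  constant : ∀ {n p} → Point R n → PolyMap n p
  constant v = polyMap 1 (λ _ → record { coeff = v ; exps = expVec 0 (λ ()) (λ { {()} }) })

  eval-constant : ∀ {n p} (v : Point R n) (α : Fin p → Carrier) j → eval (constant v) α j ≈ v j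
  eval-constant v α j = trans (+-identityʳ _) (*-identityˡ (v j))

  infixl 6 _⊕_
  _⊕_ : ∀ {n p} → PolyMap n p → PolyMap n p → PolyMap n p
  P ⊕ Q = polyMap (size P +ℕ size Q) (term P ++ term Q)

  eval-⊕ : ∀ {n p} (P Q : PolyMap n p) α j → eval (P ⊕ Q) α j ≈ eval P α j + eval Q α j
  eval-⊕ P Q α j = begin
    Sum R (size P +ℕ size Q) (λ i → value ((term P ++ term Q) i))
      ≈⟨ Sum-cong (size P +ℕ size Q) (λ i → reflexive ([,]-∘ value (splitAt (size P) i))) ⟩
    Sum R (size P +ℕ size Q) ((λ i → value (term P i)) ++ (λ i → value (term Q i)))
      ≈⟨ Sum-++ (size P) _ _ ⟩
    eval P α j + eval Q α j ∎
    where
    value : Term _ _ → Carrier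
    value t = monomial (exps t) α * coeff t j

  scale : ∀ {n p} → Carrier → PolyMap n p → PolyMap n p
  scale c P = polyMap (size P) λ i →
    record { coeff = λ j → c * coeff (term P i) j ; exps = exps (term P i) }

  eval-scale : ∀ {n p} c (P : PolyMap n p) α j → eval (scale c P) α j ≈ c * eval P α j
  eval-scale c P α j = trans
    (Sum-cong (size P) (λ i → solve 3 (λ m c g → (m :* (c :* g)) := (c :* (m :* g))) refl _ c _))
    (Sum-scale (size P) c _)

  -- Renaming the factors along an injection  f : Fin p → Fin p′; by definition
  -- eval (rename f P) α  is  eval P (α ∘ f).
  rename : ∀ {n p p′} (f : Fin p → Fin p′) → Injective _≡_ _≡_ f → PolyMap n p → PolyMap n p′
  rename f f-inj P = polyMap (size P) λ i → record
    { coeff = coeff (term P i)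
    ; exps  = let e = exps (term P i) in
              expVec (ExpVec.len e) (λ k → f (ExpVec.entries e k)) (λ eq → ExpVec.distinct e (f-inj eq))
    }

  withFactor₀ : ∀ {p} → ExpVec R p → ExpVec R (suc p)
  withFactor₀ {p} e = expVec (suc (ExpVec.len e)) entries injective
    where
    entries : Fin (suc (ExpVec.len e)) → Fin (suc p)
    entries = zero ∷ (λ k → suc (ExpVec.entries e k))
    injective : Injective _≡_ _≡_ entries
    injective {zero}  {zero}  eq = ≡.refl
    injective {suc k} {suc l} eq = ≡.cong suc (ExpVec.distinct e (suc-injective eq))

  times₀ : ∀ {n p} → PolyMap n p → PolyMap n (suc p)
  times₀ P = polyMap (size P) λ i →
    record { coeff = coeff (term P i) ; exps = withFactor₀ (exps (term P i)) }

  eval-times₀ : ∀ {n p} (P : PolyMap n p) α j → eval (times₀ P) α j ≈ α zero * eval P (tail α) j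
  eval-times₀ P α j = trans
    (Sum-cong (size P) (λ i → *-assoc (α zero) _ _))
    (Sum-scale (size P) (α zero) _)

  record ZRep (n : ℕ) : Set where
    field
      factors : ℕ
      center  : Point R n
      poly    : PolyMap n factors
  open ZRep

  point : ∀ {n} (Z : ZRep n) → (Fin (factors Z) → Carrier) → Point R n
  point Z α j = center Z j + eval (poly Z) α j

  Image : ∀ {n} → ZRep n → Point R n → Set
  Image Z = InZ R (center Z) (λ i → coeff (term (poly Z) i)) (λ i → exps (term (poly Z) i))

  point-cong : ∀ {n} (Z : ZRep n) {α β} → (∀ k → α k ≡ β k) → ∀ j → point Z α j ≈ point Z β j
  point-cong Z α≡β j = +-congˡ (eval-cong (poly Z) α≡β j)

  -- needed to fill the unused side of a join
  Image-nonempty : ∀ {n} (Z : ZRep n) → Σ (Point R n) (Image Z)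
  Image-nonempty Z = point Z (λ _ → 0#) , (λ _ → 0#) , 0∈Cube , (λ j → refl)
    where
    0∈Cube : Cube {factors Z} (λ _ → 0#)
    0∈Cube k = -1≤0 , 0≤1

  pointZ : ∀ {n} → Point R n → ZRep n
  pointZ v = record { factors = 0 ; center = v ; poly = polyMap 0 (λ ()) }

  Image-pointZ : ∀ {n} (v x : Point R n) → Image (pointZ v) x ⇔ _≈ᵥ_ R x v
  Image-pointZ v x = mk⇔
    (λ { (α , _ , x≈v+0) j → trans (x≈v+0 j) (+-identityʳ (v j)) })
    (λ x≈v → (λ ()) , (λ ()) , (λ j → trans (x≈v j) (sym (+-identityʳ (v j)))))

  leftPoly : ∀ {n} (A : ZRep n) q → PolyMap n (factors A +ℕ q)
  leftPoly A q = rename (_↑ˡ q) (λ {i} {k} → ↑ˡ-injective q i k) (poly A)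

  rightPoly : ∀ {n} p (B : ZRep n) → PolyMap n (p +ℕ factors B)
  rightPoly p B = rename (p ↑ʳ_) (λ {i} {k} → ↑ʳ-injective p i k) (poly B)

  -- The join of two Z-representations.  Its factors are  (α₀, αA, αB)  and
  --   point (join A B) (α₀, αA, αB) = weight⁺ α₀ · point A αA + weight⁻ α₀ · point B αB,
  -- realised by the center  (cA + cB)/2  and the polynomial map
  --   ½ [ (PA + PB) + α₀ ((cA - cB) + (PA - PB)) ].
  join : ∀ {n} → ZRep n → ZRep n → ZRep n
  join A B = record
    { factors = suc (factors A +ℕ factors B)
    ; center  = λ j → ½ * (center A j + center B j)
    ; poly    = scale ½ (rename suc suc-injective (PA ⊕ PB) ⊕
                         times₀ (constant (λ j → center A j + -1# * center B j) ⊕ (PA ⊕ scale -1# PB)))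
    }
    where
    PA = leftPoly A (factors B)
    PB = rightPoly (factors A) B

  module _ {n} (A B : ZRep n) (α : Fin (factors (join A B)) → Carrier) where

    leftFactors : Fin (factors A) → Carrier
    leftFactors i = α (suc (i ↑ˡ factors B))

    rightFactors : Fin (factors B) → Carrier
    rightFactors i = α (suc (factors A ↑ʳ i))

    point-join : ∀ j → point (join A B) α j ≈
      weight⁺ (α zero) * point A leftFactors j + weight⁻ (α zero) * point B rightFactors j
    point-join j = begin
      ½ * (cA + cB) + eval (poly (join A B)) α j              ≈⟨ +-congˡ eval-join ⟩
      ½ * (cA + cB) + ½ * ((SA + SB) + α₀ * ((cA + -1# * cB) + (SA + -1# * SB)))
        ≈⟨ solve 7 (λ h m a cA cB SA SB →
             ((h :* (cA :+ cB)) :+ (h :* ((SA :+ SB) :+ (a :* ((cA :+ (m :* cB)) :+ (SA :+ (m :* SB)))))))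
             := (((h :+ (h :* a)) :* (cA :+ SA)) :+ ((h :+ (h :* (m :* a))) :* (cB :+ SB))))
             refl ½ -1# α₀ cA cB SA SB ⟩
      weight⁺ α₀ * (cA + SA) + weight⁻ α₀ * (cB + SB)          ∎
      where
      α₀ = α zero
      cA = center A j
      cB = center B j
      SA = eval (poly A) leftFactors j
      SB = eval (poly B) rightFactors j
      PA = leftPoly A (factors B)
      PB = rightPoly (factors A) B
      cA-cB : Point R n
      cA-cB i = center A i + -1# * center B i
      c = constant cA-cB
      X = rename suc suc-injective (PA ⊕ PB)
      Y = PA ⊕ scale -1# PB
      eval-join : eval (poly (join A B)) α j ≈ ½ * ((SA + SB) + α₀ * ((cA + -1# * cB) + (SA + -1# * SB)))
      eval-join = begin
        eval (scale ½ (X ⊕ times₀ (c ⊕ Y))) α j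
          ≈⟨ trans (eval-scale ½ (X ⊕ times₀ (c ⊕ Y)) α j) (*-congˡ (eval-⊕ X (times₀ (c ⊕ Y)) α j)) ⟩
        ½ * (eval (PA ⊕ PB) (tail α) j + eval (times₀ (c ⊕ Y)) α j)
          ≈⟨ *-congˡ (+-cong (eval-⊕ PA PB (tail α) j) (eval-times₀ (c ⊕ Y) α j)) ⟩
        ½ * ((SA + SB) + α₀ * eval (c ⊕ Y) (tail α) j)
          ≈⟨ *-congˡ (+-congˡ (*-congˡ (trans (eval-⊕ c Y (tail α) j) (+-cong
               (eval-constant cA-cB (tail α) j)
               (trans (eval-⊕ PA (scale -1# PB) (tail α) j) (+-congˡ (eval-scale -1# PB (tail α) j))))))) ⟩
        ½ * ((SA + SB) + α₀ * ((cA + -1# * cB) + (SA + -1# * SB))) ∎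

  Image-join⁻ : ∀ {n} (A B : ZRep n) x → Image (join A B) x → Join (Image A) (Image B) x
  Image-join⁻ A B x (α , α∈Cube , x≈point) =
    mix (weight⁺ (α zero)) (weight⁻ (α zero)) (point A (leftFactors A B α)) (point B (rightFactors A B α))
        (weight⁺-nonneg (proj₁ (α∈Cube zero))) (weight⁻-nonneg (proj₂ (α∈Cube zero))) (weights-sum (α zero))
        (leftFactors A B α , (λ i → α∈Cube (suc (i ↑ˡ factors B))) , (λ j → refl))
        (rightFactors A B α , (λ i → α∈Cube (suc (factors A ↑ʳ i))) , (λ j → refl))
        (λ j → trans (x≈point j) (point-join A B α j))

  Image-join⁺ : ∀ {n} (A B : ZRep n) x → Join (Image A) (Image B) x → Image (join A B) x
  Image-join⁺ A B x (mix t s a b 0≤t 0≤s t+s≈1 (αA , αA∈Cube , a≈) (αB , αB∈Cube , b≈) x≈ta+sb) =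
    α , Cube-∷ (mixing-parameter-bounds 0≤t 0≤s t+s≈1) (Cube-++ (factors A) αA∈Cube αB∈Cube) , x≈point
    where
    α : Fin (factors (join A B)) → Carrier
    α = mixing-parameter t s ∷ (αA ++ αB)
    x≈point : ∀ j → x j ≈ point (join A B) α j
    x≈point j = begin
      x j                                                   ≈⟨ x≈ta+sb j ⟩
      t * a j + s * b j
        ≈⟨ +-cong (*-cong (sym (weight⁺-mixing-parameter t+s≈1)) (a≈ j))
                  (*-cong (sym (weight⁻-mixing-parameter t+s≈1)) (b≈ j)) ⟩
      weight⁺ (α zero) * point A αA j + weight⁻ (α zero) * point B αB j
        ≈⟨ +-cong (*-congˡ (point-cong A (λ i → ≡.sym (lookup-++ˡ αA αB i)) j))
                  (*-congˡ (point-cong B (λ i → ≡.sym (lookup-++ʳ αA αB i)) j)) ⟩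
      weight⁺ (α zero) * point A (leftFactors A B α) j + weight⁻ (α zero) * point B (rightFactors A B α) j
        ≈⟨ point-join A B α j ⟨
      point (join A B) α j                                  ∎

  Image-join-⊆ : ∀ {n} (A B : ZRep n) (P : Point R n → Set) → Convex P →
                 (∀ x → Image A x → P x) → (∀ x → Image B x → P x) → ∀ x → Image (join A B) x → P x
  Image-join-⊆ A B P P-convex A⊆P B⊆P x x∈join =
    P-convex x (Join-map A⊆P B⊆P x (Image-join⁻ A B x x∈join))

module Polytopes (R : RealField) where
  open RealField R hiding (zero)
  open OrderedField R
  open FiniteSums R
  open ConvexSets R
  open ZRepresentations R
  open import Relation.Binary.Reasoning.Setoid setoid

  InVPolytope-convex : ∀ {n q} (v : Fin q → Point R n) → Convex (InVPolytope R v)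
  InVPolytope-convex {n} {q} v x (mix t s a b 0≤t 0≤s t+s≈1 (βa , βa≥0 , βa-sum , a≈) (βb , βb≥0 , βb-sum , b≈) x≈) =
    β , β≥0 , β-sum , x≈Σβv
    where
    β : Fin q → Carrier
    β i = t * βa i + s * βb i
    β≥0 : ∀ i → 0# ≤ β i
    β≥0 i = ≤-resp-≈ (+-identityˡ 0#) refl
              (+-mono₂-≤ (*-nonneg _ _ 0≤t (βa≥0 i)) (*-nonneg _ _ 0≤s (βb≥0 i)))
    Sum-mix : (f g : Fin q → Carrier) → Sum R q (λ i → t * f i + s * g i) ≈ t * Sum R q f + s * Sum R q g
    Sum-mix f g = trans (Sum-+ q _ _) (+-cong (Sum-scale q t f) (Sum-scale q s g))
    β-sum : Sum R q β ≈ 1#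
    β-sum = begin
      Sum R q β                    ≈⟨ Sum-mix βa βb ⟩
      t * Sum R q βa + s * Sum R q βb ≈⟨ +-cong (*-congˡ βa-sum) (*-congˡ βb-sum) ⟩
      t * 1# + s * 1#              ≈⟨ +-cong (*-identityʳ t) (*-identityʳ s) ⟩
      t + s                        ≈⟨ t+s≈1 ⟩
      1#                           ∎
    x≈Σβv : ∀ j → x j ≈ Sum R q (λ i → β i * v i j)
    x≈Σβv j = begin
      x j                                      ≈⟨ x≈ j ⟩
      t * a j + s * b j                        ≈⟨ +-cong (*-congˡ (a≈ j)) (*-congˡ (b≈ j)) ⟩
      t * Sum R q (λ i → βa i * v i j) + s * Sum R q (λ i → βb i * v i j) ≈⟨ Sum-mix _ _ ⟨
      Sum R q (λ i → t * (βa i * v i j) + s * (βb i * v i j))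
        ≈⟨ Sum-cong q (λ i → solve 5 (λ t s a b w → ((t :* (a :* w)) :+ (s :* (b :* w)))
                                                 := (((t :* a) :+ (s :* b)) :* w)) refl t s (βa i) (βb i) (v i j)) ⟩
      Sum R q (λ i → β i * v i j)              ∎

  unit : ∀ {q} → Fin q → Fin q → Carrier
  unit k i with k ≟ i
  ... | yes _ = 1#
  ... | no  _ = 0#

  unit-nonneg : ∀ {q} (k i : Fin q) → 0# ≤ unit k i
  unit-nonneg k i with k ≟ i
  ... | yes _ = 0≤1
  ... | no  _ = ≤-refl

  Sum-unit : ∀ q (k : Fin (suc q)) (f : Fin (suc q) → Carrier) → Sum R (suc q) (λ i → unit k i * f i) ≈ f k
  Sum-unit q k f = begin
    Sum R (suc q) (λ i → unit k i * f i)                     ≈⟨ Sum-punchIn q (λ i → unit k i * f i) k ⟩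
    unit k k * f k + Sum R q (λ i → unit k (punchIn k i) * f (punchIn k i))
      ≈⟨ +-cong (*-congʳ unit-self) (Sum-zero q _ (λ i → trans (*-congʳ (unit-other i)) (zeroˡ _))) ⟩
    1# * f k + 0#                                            ≈⟨ trans (+-identityʳ _) (*-identityˡ (f k)) ⟩
    f k                                                      ∎
    where
    unit-self : unit k k ≈ 1#
    unit-self with k ≟ k
    ... | yes _  = refl
    ... | no k≢k = ⊥-elim (k≢k ≡.refl)
    unit-other : ∀ i → unit k (punchIn k i) ≈ 0#
    unit-other i with k ≟ punchIn k i
    ... | yes k≡k′ = ⊥-elim (punchInᵢ≢i k i (≡.sym k≡k′))
    ... | no  _    = refl

  vertex∈InVPolytope : ∀ {n q} (v : Fin (suc q) → Point R n) k → InVPolytope R v (v k)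
  vertex∈InVPolytope {q = q} v k =
    unit k , unit-nonneg k ,
    trans (Sum-cong (suc q) (λ i → sym (*-identityʳ (unit k i)))) (Sum-unit q k (λ _ → 1#)) ,
    (λ j → sym (Sum-unit q k (λ i → v i j)))

  record LastWeighted {n m} (u : Fin m → Point R n) (l x : Point R n) : Set where
    constructor lastWeighted
    field
      γ        : Fin m → Carrier
      γₗ       : Carrier
      γ≥0      : ∀ i → 0# ≤ γ i
      γₗ≥0     : 0# ≤ γₗ
      γₗ≉0     : ¬ (γₗ ≈ 0#)
      γ-sum    : Sum R m γ + γₗ ≈ 1#
      x≈Σγu    : _≈ᵥ_ R x (λ j → Sum R m (λ i → γ i * u i j) + γₗ * l j)

  -- Splitting off the first point:  x = γ₀ u₀ + r y  where  r = 1 - γ₀  is at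
  -- least  γₗ ≉ 0, so the remaining weights can be renormalised by  r⁻¹.
  split-first : ∀ {n m} {u : Fin (suc m) → Point R n} {l x} →
                LastWeighted u l x → Join (λ y → _≈ᵥ_ R y (u zero)) (LastWeighted (tail u) l) x
  split-first {n} {m} {u} {l} {x} (lastWeighted γ γₗ γ≥0 γₗ≥0 γₗ≉0 γ-sum x≈Σγu) =
    mix (γ zero) r (u zero) y (γ≥0 zero) (≤-trans γₗ≥0 γₗ≤r) (trans (sym (+-assoc _ _ _)) γ-sum) (λ j → refl)
        y-weighted x≈γ₀u₀+ry
    where
    r : Carrier
    r = Sum R m (tail γ) + γₗ
    γₗ≤r : γₗ ≤ r
    γₗ≤r = ≤-resp-≈ (+-identityˡ γₗ) refl (+-mono-≤ 0# _ γₗ (Sum-nonneg m (tail γ) (λ i → γ≥0 (suc i))))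
    r≉0 : ¬ (r ≈ 0#)
    r≉0 r≈0 = γₗ≉0 (antisym (≤-resp-≈ refl r≈0 γₗ≤r) γₗ≥0)
    r⁻¹ : Carrier
    r⁻¹ = proj₁ (inverse r r≉0)
    rr⁻¹≈1 : r * r⁻¹ ≈ 1#
    rr⁻¹≈1 = proj₂ (inverse r r≉0)
    0≤r⁻¹ : 0# ≤ r⁻¹
    0≤r⁻¹ = inverse-nonneg (≤-trans γₗ≥0 γₗ≤r) rr⁻¹≈1
    r[r⁻¹g]≈g : ∀ g → r * (r⁻¹ * g) ≈ g
    r[r⁻¹g]≈g g = trans (sym (*-assoc r r⁻¹ g)) (trans (*-congʳ rr⁻¹≈1) (*-identityˡ g))
    y : Point R n
    y j = Sum R m (λ i → (r⁻¹ * γ (suc i)) * u (suc i) j) + (r⁻¹ * γₗ) * l j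
    y-weighted : LastWeighted (tail u) l y
    y-weighted = lastWeighted (λ i → r⁻¹ * γ (suc i)) (r⁻¹ * γₗ)
      (λ i → *-nonneg _ _ 0≤r⁻¹ (γ≥0 (suc i))) (*-nonneg _ _ 0≤r⁻¹ γₗ≥0)
      (λ r⁻¹γₗ≈0 → γₗ≉0 (trans (sym (r[r⁻¹g]≈g γₗ)) (trans (*-congˡ r⁻¹γₗ≈0) (zeroʳ r))))
      (begin
        Sum R m (λ i → r⁻¹ * γ (suc i)) + r⁻¹ * γₗ  ≈⟨ +-congʳ (Sum-scale m r⁻¹ (tail γ)) ⟩
        r⁻¹ * Sum R m (tail γ) + r⁻¹ * γₗ          ≈⟨ distribˡ r⁻¹ _ γₗ ⟨
        r⁻¹ * r                                    ≈⟨ *-comm r⁻¹ r ⟩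
        r * r⁻¹                                    ≈⟨ rr⁻¹≈1 ⟩
        1#                                         ∎)
      (λ j → refl)
    x≈γ₀u₀+ry : ∀ j → x j ≈ γ zero * u zero j + r * y j
    x≈γ₀u₀+ry j = begin
      x j                                                                       ≈⟨ x≈Σγu j ⟩
      (γ zero * u zero j + Sum R m (λ i → γ (suc i) * u (suc i) j)) + γₗ * l j  ≈⟨ +-assoc _ _ _ ⟩
      γ zero * u zero j + (Sum R m (λ i → γ (suc i) * u (suc i) j) + γₗ * l j)
        ≈⟨ +-congˡ (+-cong (Sum-cong m (λ i → sym (rescaled (γ (suc i)) (u (suc i) j)))) (sym (rescaled γₗ (l j)))) ⟩
      γ zero * u zero j + (Sum R m (λ i → r * ((r⁻¹ * γ (suc i)) * u (suc i) j)) + r * ((r⁻¹ * γₗ) * l j))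
        ≈⟨ +-congˡ (+-congʳ (Sum-scale m r _)) ⟩
      γ zero * u zero j + (r * Sum R m (λ i → (r⁻¹ * γ (suc i)) * u (suc i) j) + r * ((r⁻¹ * γₗ) * l j))
        ≈⟨ +-congˡ (distribˡ r _ _) ⟨
      γ zero * u zero j + r * y j                                               ∎
      where
      rescaled : ∀ g w → r * ((r⁻¹ * g) * w) ≈ g * w
      rescaled g w = trans (*-congˡ (*-assoc r⁻¹ g w)) (r[r⁻¹g]≈g (g * w))

  chain : ∀ {n} m → (Fin m → Point R n) → Point R n → ZRep n
  chain zero    u l = pointZ l
  chain (suc m) u l = join (pointZ (u zero)) (chain m (tail u) l)

  chain-complete : ∀ {n} m (u : Fin m → Point R n) l x → LastWeighted u l x → Image (chain m u l) x
  chain-complete zero u l x (lastWeighted γ γₗ _ _ _ γ-sum x≈Σγu) =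
    Equivalence.from (Image-pointZ l x) λ j → begin
      x j              ≈⟨ x≈Σγu j ⟩
      0# + γₗ * l j    ≈⟨ +-identityˡ _ ⟩
      γₗ * l j         ≈⟨ *-congʳ (trans (sym (+-identityˡ γₗ)) γ-sum) ⟩
      1# * l j         ≈⟨ *-identityˡ (l j) ⟩
      l j              ∎
  chain-complete (suc m) u l x w =
    Image-join⁺ (pointZ (u zero)) (chain m (tail u) l) x
      (Join-map (λ y → Equivalence.from (Image-pointZ (u zero) y)) (chain-complete m (tail u) l) x (split-first w))

  Image-pointZ-⊆ : ∀ {n} (v : Point R n) (P : Point R n → Set) → Convex P → P v → ∀ x → Image (pointZ v) x → P x
  Image-pointZ-⊆ v P P-convex v∈P x x∈ = convex-resp P P-convex v∈P (Equivalence.to (Image-pointZ v x) x∈)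

  chain-⊆ : ∀ {n} m (u : Fin m → Point R n) l (P : Point R n → Set) → Convex P →
            (∀ i → P (u i)) → P l → ∀ x → Image (chain m u l) x → P x
  chain-⊆ zero    u l P P-convex u⊆P l∈P = Image-pointZ-⊆ l P P-convex l∈P
  chain-⊆ (suc m) u l P P-convex u⊆P l∈P =
    Image-join-⊆ (pointZ (u zero)) (chain m (tail u) l) P P-convex
      (Image-pointZ-⊆ (u zero) P P-convex (u⊆P zero))
      (chain-⊆ m (tail u) l P P-convex (λ i → u⊆P (suc i)) l∈P)

  joinAll : ∀ {n} m → (Fin (suc m) → ZRep n) → ZRep n
  joinAll zero    F = F zero
  joinAll (suc m) F = join (F zero) (joinAll m (tail F))

  joinAll-⊇ : ∀ {n} m (F : Fin (suc m) → ZRep n) k x → Image (F k) x → Image (joinAll m F) x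
  joinAll-⊇ zero    F zero    x x∈ = x∈
  joinAll-⊇ (suc m) F zero    x x∈ =
    Image-join⁺ (F zero) (joinAll m (tail F)) x (Join-left x∈ (proj₂ (Image-nonempty (joinAll m (tail F)))))
  joinAll-⊇ (suc m) F (suc k) x x∈ =
    Image-join⁺ (F zero) (joinAll m (tail F)) x (Join-right (proj₂ (Image-nonempty (F zero))) (joinAll-⊇ m (tail F) k x x∈))

  joinAll-⊆ : ∀ {n} m (F : Fin (suc m) → ZRep n) (P : Point R n → Set) → Convex P →
              (∀ k x → Image (F k) x → P x) → ∀ x → Image (joinAll m F) x → P x
  joinAll-⊆ zero    F P P-convex F⊆P = F⊆P zero
  joinAll-⊆ (suc m) F P P-convex F⊆P =
    Image-join-⊆ (F zero) (joinAll m (tail F)) P P-convex (F⊆P zero) (joinAll-⊆ m (tail F) P P-convex (λ k → F⊆P (suc k)))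

  max-weight≉0 : ∀ q (β : Fin q → Carrier) k → (∀ i → 0# ≤ β i) → Sum R q β ≈ 1# →
                 (∀ i → β i ≤ β k) → ¬ (β k ≈ 0#)
  max-weight≉0 q β k β≥0 β-sum β≤βk βk≈0 =
    1≉0 (trans (sym β-sum) (Sum-zero q β (λ i → antisym (≤-resp-≈ refl βk≈0 (β≤βk i)) (β≥0 i))))

  polytopeZ : ∀ {n} q → (Fin (suc q) → Point R n) → ZRep n
  polytopeZ q v = joinAll q (λ k → chain q (λ i → v (punchIn k i)) (v k))

  polytopeZ-⊇ : ∀ {n} q (v : Fin (suc q) → Point R n) x → InVPolytope R v x → Image (polytopeZ q v) x
  polytopeZ-⊇ q v x (β , β≥0 , β-sum , x≈Σβv) with argmax q β
  ... | k , β≤βk = joinAll-⊇ q _ k x (chain-complete q (λ i → v (punchIn k i)) (v k) x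
        (lastWeighted (λ i → β (punchIn k i)) (β k) (λ i → β≥0 (punchIn k i)) (β≥0 k)
                      (max-weight≉0 (suc q) β k β≥0 β-sum β≤βk)
                      (trans (+-comm _ _) (trans (sym (Sum-punchIn q β k)) β-sum))
                      (λ j → trans (x≈Σβv j) (trans (Sum-punchIn q (λ i → β i * v i j) k) (+-comm _ _)))))

  polytopeZ-⊆ : ∀ {n} q (v : Fin (suc q) → Point R n) x → Image (polytopeZ q v) x → InVPolytope R v x
  polytopeZ-⊆ q v = joinAll-⊆ q _ (InVPolytope R v) (InVPolytope-convex v) λ k →
    chain-⊆ q _ (v k) (InVPolytope R v) (InVPolytope-convex v)
      (λ i → vertex∈InVPolytope v (punchIn k i)) (vertex∈InVPolytope v k)

theorem1 : (R : RealField) → (n q : ℕ) → (v : Fin (suc q) → Point R n) →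
    Σ (Point R n) λ c → Σ ℕ λ h → Σ (Fin h → Point R n) λ G →
    Σ ℕ λ p → Σ (Fin h → ExpVec R p) λ E →
    (x : Point R n) → InVPolytope R v x ⇔ InZ R c G E x
-- The polytope  conv{v₀, …, v_q}  is the image of  polytopeZ q v; read off its
-- center, generators, number of factors and exponent vectors.
theorem1 R n q v =
  center Z , size (poly Z) , (λ i → coeff (term (poly Z) i)) ,
  factors Z , (λ i → exps (term (poly Z) i)) ,
  λ x → mk⇔ (polytopeZ-⊇ q v x) (polytopeZ-⊆ q v x)
  where
  open ZRepresentations R
  open Polytopes R
  open ZRep
  open PolyMap
  open Term
  Z : ZRep n
  Z = polytopeZ q v
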